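{- Assume that $d_n^2 < 2p_n$ for every integer $n\geq 1$ with $n\neq 4$. Then for every $n\geq 1$, $$d_n = \lfloor \sqrt{p_{n+1}}\Delta_n\rfloor + \lfloor \sqrt{p_n}\Delta_n\rfloor + 1.$$ Moreover, for every integer $n\geq 2$: $d_n = 2\lfloor \sqrt{p_{n+1}}\Delta_n\rfloor = 2\left(\lfloor \sqrt{p_n}\Delta_n\rfloor + 1\right)$; the fractional part $\{\sqrt{p_{n+1}}\Delta_n\}$ lies between $0$ and $1/2$; and the integers $\lfloor \sqrt{p_{n+1}}\Delta_n\rfloor$ and $\lfloor \sqrt{p_n}\Delta_n\rfloor$ have opposite parities.
   Context: $p_n$ denotes the $n$th prime ($p_1=2$), $d_n := p_{n+1}-p_n$, $\Delta_n := \sqrt{p_{n+1}}-\sqrt{p_n}$. $\lfloor x\rfloor$ and $\{x\}=x-\lfloor x\rfloor$ are the integer and fractional parts of $x$. -}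

module Defs where

open import Data.Nat as ℕ using (ℕ; suc)
open import Data.Nat.Primality using (Prime; prime?)
open import Data.List using (List; length; filter; upTo)
open import Data.Integer using (ℤ; +_; _+_; _-_; _*_; _≤_; _<_; 0ℤ; 1ℤ)
open import Data.Integer.Divisibility using (_∣_)
open import Data.Product using (_×_)
open import Data.Sum using (_⊎_)
open import Relation.Nullary using (¬_)

primeCount : ℕ → ℕ
primeCount x = length (filter prime? (upTo (suc x)))

-- q is the n-th prime  (n ≥ 1; p₁ = 2)
IsNthPrime : ℕ → ℕ → Set
IsNthPrime n q = Prime q × primeCount q ≡ℕ n
  where
  open import Relation.Binary.PropositionalEquality using () renaming (_≡_ to _≡ℕ_)

-- Comparisons of √m (m : ℕ, the nonnegative real square root) with
-- integers c, written out without real numbers.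

SqrtLe : ℕ → ℤ → Set
SqrtLe m c = (0ℤ ≤ c) × (+ m ≤ c * c)

SqrtLt : ℕ → ℤ → Set
SqrtLt m c = (0ℤ < c) × (+ m < c * c)

LeSqrt : ℤ → ℕ → Set
LeSqrt c m = (c ≤ 0ℤ) ⊎ (c * c ≤ + m)

LtSqrt : ℤ → ℕ → Set
LtSqrt c m = (c < 0ℤ) ⊎ (c * c < + m)

-- k = ⌊a - √m⌋ ,  i.e.  k ≤ a - √m < k + 1
IsFloorMinusSqrt : ℤ → ℕ → ℤ → Set
IsFloorMinusSqrt a m k = SqrtLe m (a - k) × LtSqrt (a - k - 1ℤ) m

-- k = ⌊√m - a⌋ ,  i.e.  k ≤ √m - a < k + 1
IsFloorSqrtMinus : ℕ → ℤ → ℤ → Set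
IsFloorSqrtMinus m a k = LeSqrt (k + a) m × SqrtLt m (k + a + 1ℤ)

-- Given k = ⌊a - √m⌋, the fractional part {a - √m} lies strictly
-- between 0 and 1/2, i.e.  k < a - √m < k + 1/2 ; equivalently
-- √m < a - k  and  2(a - k) - 1 < 2√m = √(4m).
FracMinusSqrtBetween0Half : ℤ → ℕ → ℤ → Set
FracMinusSqrtBetween0Half a m k =
  SqrtLt m (a - k) × LtSqrt ((a - k) + (a - k) - 1ℤ) (4 ℕ.* m)

Even : ℤ → Set
Even k = (+ 2) ∣ k

OppositeParity : ℤ → ℤ → Set
OppositeParity k l = (Even k × ¬ Even l) ⊎ (¬ Even k × Even l)

{-# OPTIONS --safe #-}
-- Since √r Δ = r - √(qr) and √q Δ = √(qr) - q, everything is governed by s = ⌊√(qr)⌋.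
-- As qr is not a square, √(qr) is not an integer, so r - k = s + 1 and l + q = s, whence
-- r - q = k + l + 1. For n ≥ 2 both primes are odd, so r = q + 2g with g ≥ 1, and the gap
-- hypothesis (or the direct check for n = 4) gives g² < q. Then (q + g - 1)² ≤ qr < (q + g)²,
-- i.e. s = q + g - 1, whence k = g and l = g - 1; moreover (2s + 1)² < 4qr, so √(qr) lies
-- above s + ½ and the fractional part of r - √(qr) is below ½.
module Submission where

open import Defs

module _ where
  open import Data.Nat
  open import Data.Nat.Properties
  open import Data.Nat.Primality
    using (Prime; prime?; prime⇒irreducible; prime⇒nonTrivial; prime⇒nonZero; euclidsLemma)
  open import Data.Nat.Divisibility
  open import Data.Nat.Tactic.RingSolver using (solve)
  open import Data.List using ([]; _∷_; [_]; _++_; filter; length; upTo)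
  open import Data.List.Properties using (upTo-∷ʳ; filter-++; filter-accept; length-++)
  open import Data.Product using (_,_; _×_; ∃-syntax)
  open import Data.Sum using (_⊎_; inj₁; inj₂; [_,_]′)
  open import Function using (_∘_; id)
  open import Relation.Binary.Definitions using (tri<; tri≈; tri>)
  open import Relation.Binary.PropositionalEquality hiding ([_])
  open import Relation.Nullary using (¬_; yes; no; contradiction)
  open import Relation.Nullary.Decidable using (from-yes)

  primeCount-suc : ∀ x → primeCount (suc x) ≡ primeCount x + length (filter prime? [ suc x ])
  primeCount-suc x = begin
    length (filter prime? (upTo (suc (suc x))))
      ≡⟨ cong (length ∘ filter prime?) (upTo-∷ʳ (suc x)) ⟨
    length (filter prime? (upTo (suc x) ++ [ suc x ]))
      ≡⟨ cong length (filter-++ prime? (upTo (suc x)) [ suc x ]) ⟩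
    length (filter prime? (upTo (suc x)) ++ filter prime? [ suc x ])
      ≡⟨ length-++ (filter prime? (upTo (suc x))) ⟩
    primeCount x + length (filter prime? [ suc x ]) ∎
    where open ≡-Reasoning

  primeCount-suc-prime : ∀ {x} → Prime (suc x) → primeCount (suc x) ≡ suc (primeCount x)
  primeCount-suc-prime {x} p = begin
    primeCount (suc x)
      ≡⟨ primeCount-suc x ⟩
    primeCount x + length (filter prime? [ suc x ])
      ≡⟨ cong (λ xs → primeCount x + length xs) (filter-accept prime? p) ⟩
    primeCount x + 1
      ≡⟨ +-comm (primeCount x) 1 ⟩
    suc (primeCount x) ∎
    where open ≡-Reasoning

  primeCount-mono-≤ : ∀ {x y} → x ≤ y → primeCount x ≤ primeCount y
  primeCount-mono-≤ = go ∘ ≤⇒≤′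
    where
    go : ∀ {x y} → x ≤′ y → primeCount x ≤ primeCount y
    go ≤′-refl = ≤-refl
    go {y = suc y} (≤′-step x≤′y) =
      ≤-trans (go x≤′y) (≤-trans (m≤m+n _ _) (≤-reflexive (sym (primeCount-suc y))))

  primeCount-mono-< : ∀ {x y} → x < y → Prime y → primeCount x < primeCount y
  primeCount-mono-< (s≤s x≤y) p rewrite primeCount-suc-prime p = s≤s (primeCount-mono-≤ x≤y)

  nthPrime-< : ∀ {n q r} → IsNthPrime n q → IsNthPrime (suc n) r → q < r
  nthPrime-< (_ , refl) (_ , πr≡1+πq) =
    ≰⇒> λ r≤q → 1+n≰n (≤-trans (≤-reflexive (sym πr≡1+πq)) (primeCount-mono-≤ r≤q))

  nthPrime-unique : ∀ {n q q′} → IsNthPrime n q → IsNthPrime n q′ → q ≡ q′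
  nthPrime-unique {q = q} {q′} (pq , refl) (pq′ , πq′≡πq) with <-cmp q q′
  ... | tri< q<q′ _ _ = contradiction πq′≡πq (>⇒≢ (primeCount-mono-< q<q′ pq′))
  ... | tri≈ _ q≡q′ _ = q≡q′
  ... | tri> _ _ q′<q = contradiction πq′≡πq (<⇒≢ (primeCount-mono-< q′<q pq))

  nthPrime≢2 : ∀ {n q} → 2 ≤ n → IsNthPrime n q → q ≢ 2
  nthPrime≢2 (s≤s ()) (_ , refl) refl

  p₄≡7 : ∀ {q} → IsNthPrime 4 q → q ≡ 7
  p₄≡7 p₄ = nthPrime-unique p₄ (from-yes (prime? 7) , refl)

  p₅≡11 : ∀ {r} → IsNthPrime 5 r → r ≡ 11
  p₅≡11 p₅ = nthPrime-unique p₅ (from-yes (prime? 11) , refl)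

  2∣n⊎2∣1+n : ∀ n → 2 ∣ n ⊎ 2 ∣ suc n
  2∣n⊎2∣1+n zero    = inj₁ (divides 0 refl)
  2∣n⊎2∣1+n (suc n) = [ inj₂ ∘ ∣m∣n⇒∣m+n (n∣n {2}) , inj₁ ]′ (2∣n⊎2∣1+n n)

  2∣n⇒2∤1+n : ∀ {n} → 2 ∣ n → ¬ 2 ∣ suc n
  2∣n⇒2∤1+n {n} 2∣n 2∣1+n =
    contradiction (∣1⇒≡1 (∣m+n∣m⇒∣n (subst (2 ∣_) (+-comm 1 n) 2∣1+n) 2∣n)) λ ()

  prime≢2⇒2∤ : ∀ {p} → Prime p → p ≢ 2 → ¬ 2 ∣ p
  prime≢2⇒2∤ pp p≢2 2∣p = [ (λ ()) , p≢2 ∘ sym ]′ (prime⇒irreducible pp 2∣p)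

  nthPrime-odd : ∀ {n q} → 2 ≤ n → IsNthPrime n q → ¬ 2 ∣ q
  nthPrime-odd 2≤n pₙ@(pq , _) = prime≢2⇒2∤ pq (nthPrime≢2 2≤n pₙ)

  2∤∧2∤⇒2∣gap : ∀ {q d} → ¬ 2 ∣ q → ¬ 2 ∣ q + d → 2 ∣ d
  2∤∧2∤⇒2∣gap {q} {d} 2∤q 2∤q+d with 2∣n⊎2∣1+n q | 2∣n⊎2∣1+n d
  ... | inj₁ 2∣q   | _          = contradiction 2∣q 2∤q
  ... | inj₂ _     | inj₁ 2∣d   = 2∣d
  ... | inj₂ 2∣1+q | inj₂ 2∣1+d = contradiction 2∣q+d 2∤q+d
    where
    2∣q+d : 2 ∣ q + d
    2∣q+d = ∣m+n∣m⇒∣n (subst (2 ∣_) (cong suc (+-suc q d)) (∣m∣n⇒∣m+n 2∣1+q 2∣1+d)) (n∣n {2})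

  2∤<2∤⇒evenGap : ∀ {q r} → ¬ 2 ∣ q → ¬ 2 ∣ r → q < r → ∃[ f ] r ≡ q + 2 * suc f
  2∤<2∤⇒evenGap {q} 2∤q 2∤r q<r with o , refl ← m≤n⇒∃[o]m+o≡n q<r
    with 2∤∧2∤⇒2∣gap 2∤q (2∤r ∘ subst (2 ∣_) (+-suc q o))
  ... | divides (suc f) 1+o≡[1+f]*2 = f , (begin
    suc q + o    ≡⟨ +-suc q o ⟨
    q + suc o    ≡⟨ cong (q +_) (trans 1+o≡[1+f]*2 (*-comm (suc f) 2)) ⟩
    q + 2 * suc f ∎)
    where open ≡-Reasoning

  IsFloorSqrt : ℕ → ℕ → Set
  IsFloorSqrt m s = s * s ≤ m × m < suc s * suc s

  NonSquare : ℕ → Set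
  NonSquare m = ∀ c → c * c ≢ m

  s²≤m<[1+t]²⇒s≤t : ∀ {m s t} → s * s ≤ m → m < suc t * suc t → s ≤ t
  s²≤m<[1+t]²⇒s≤t {m} s²≤m m<[1+t]² =
    ≮⇒≥ λ t<s → n≮n m (<-≤-trans m<[1+t]² (≤-trans (*-mono-≤ t<s t<s) s²≤m))

  isFloorSqrt-unique : ∀ {m s t} → IsFloorSqrt m s → IsFloorSqrt m t → s ≡ t
  isFloorSqrt-unique (s²≤m , m<[1+s]²) (t²≤m , m<[1+t]²) =
    ≤-antisym (s²≤m<[1+t]²⇒s≤t s²≤m m<[1+t]²) (s²≤m<[1+t]²⇒s≤t t²≤m m<[1+s]²)

  nonSquare-*-distinctPrimes : ∀ {p q} → Prime p → Prime q → p ≢ q → NonSquare (p * q)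
  nonSquare-*-distinctPrimes {p} {q} pp pq p≢q c c²≡pq =
    [ nonTrivial⇒≢1 {{prime⇒nonTrivial pp}} , p≢q ]′ (prime⇒irreducible pq p∣q)
    where
    instance _ = prime⇒nonZero pp
    p∣c : p ∣ c
    p∣c = [ id , id ]′ (euclidsLemma c c pp (subst (p ∣_) (sym c²≡pq) (m∣m*n q)))
    p∣q : p ∣ q
    p∣q = *-cancelˡ-∣ p (subst (p * p ∣_) c²≡pq (*-pres-∣ p∣c p∣c))

  isFloorSqrt-evenGap : ∀ q f → suc f * suc f ≤ q → IsFloorSqrt (q * (q + 2 * suc f)) (q + f)
  isFloorSqrt-evenGap q f [1+f]²≤q = lower , upper
    where
    open ≤-Reasoning
    f²≤2q : f * f ≤ 2 * q
    f²≤2q = ≤-trans (*-mono-≤ (n≤1+n f) (n≤1+n f)) (≤-trans [1+f]²≤q (m≤n*m q 2))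
    lower : (q + f) * (q + f) ≤ q * (q + 2 * suc f)
    lower = begin
      (q + f) * (q + f)         ≡⟨ solve (q ∷ f ∷ []) ⟩
      q * q + 2 * q * f + f * f ≤⟨ +-monoʳ-≤ (q * q + 2 * q * f) f²≤2q ⟩
      q * q + 2 * q * f + 2 * q ≡⟨ solve (q ∷ f ∷ []) ⟩
      q * (q + 2 * suc f)       ∎
    upper : q * (q + 2 * suc f) < suc (q + f) * suc (q + f)
    upper = begin-strict
      q * (q + 2 * suc f)                   <⟨ m<m+n _ z<s ⟩
      q * (q + 2 * suc f) + suc f * suc f   ≡⟨ solve (q ∷ f ∷ []) ⟩
      suc (q + f) * suc (q + f)             ∎

  [2[q+f]+1]²<4q[q+2[1+f]] : ∀ q f → suc f * suc f ≤ q →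
    (2 * (q + f) + 1) * (2 * (q + f) + 1) < 4 * (q * (q + 2 * suc f))
  [2[q+f]+1]²<4q[q+2[1+f]] q f [1+f]²≤q = begin-strict
    (2 * (q + f) + 1) * (2 * (q + f) + 1)
      <⟨ m<m+n _ z<s ⟩
    (2 * (q + f) + 1) * (2 * (q + f) + 1) + (3 + 4 * f)
      ≡⟨ solve (q ∷ f ∷ []) ⟩
    4 * q * q + 8 * q * f + 4 * q + 4 * (suc f * suc f)
      ≤⟨ +-monoʳ-≤ (4 * q * q + 8 * q * f + 4 * q) (*-monoʳ-≤ 4 [1+f]²≤q) ⟩
    4 * q * q + 8 * q * f + 4 * q + 4 * q
      ≡⟨ solve (q ∷ f ∷ []) ⟩
    4 * (q * (q + 2 * suc f)) ∎
    where open ≤-Reasoning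

  SquareGapBound : Set
  SquareGapBound =
    ∀ n q r → 1 ≤ n → n ≢ 4 → IsNthPrime n q → IsNthPrime (suc n) r → (r ∸ q) ^ 2 < 2 * q

  -- The excluded case d₄ = 11 - 7 = 4 fails d² < 2p but satisfies d² < 4p, which is all
  -- that is needed.
  squareGapBound⇒gap²<4p : SquareGapBound → ∀ {n q r} → 1 ≤ n →
    IsNthPrime n q → IsNthPrime (suc n) r → (r ∸ q) ^ 2 < 4 * q
  squareGapBound⇒gap²<4p bound {n} {q} 1≤n pₙ pₙ₊₁ with n ≟ 4
  ... | no n≢4    = ≤-trans (bound _ _ _ 1≤n n≢4 pₙ pₙ₊₁) (*-monoˡ-≤ q {2} {4} (s≤s (s≤s z≤n)))
  ... | yes refl rewrite p₄≡7 pₙ | p₅≡11 pₙ₊₁ = from-yes ((11 ∸ 7) ^ 2 <? 4 * 7)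

  gap²<4q⇒halfGap²<q : ∀ {q r g} → r ≡ q + 2 * g → (r ∸ q) ^ 2 < 4 * q → g * g < q
  gap²<4q⇒halfGap²<q {q} {g = g} refl gap²<4q = *-cancelˡ-< 4 (g * g) q (begin-strict
    4 * (g * g)         ≡⟨ solve (g ∷ []) ⟩
    2 * g * (2 * g * 1) ≡⟨⟩
    (2 * g) ^ 2         ≡⟨ cong (_^ 2) (m+n∸m≡n q (2 * g)) ⟨
    (q + 2 * g ∸ q) ^ 2 <⟨ gap²<4q ⟩
    4 * q               ∎)
    where open ≤-Reasoning

module _ where
  open import Data.Nat using (suc; z≤n; s≤s)
    renaming (_+_ to _+ℕ_; _*_ to _*ℕ_; _≤_ to _≤ℕ_; _<_ to _<ℕ_)
  import Data.Nat.Properties as ℕ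
  import Data.Nat.Tactic.RingSolver as ℕ-Solver
  open import Data.Integer
    using (ℤ; +_; +[1+_]; -[1+_]; _+_; _-_; _*_; _<_; 1ℤ; +≤+; +<+)
  open import Data.Integer.Properties using (+-0-abelianGroup; +-comm; pos-*; drop‿+<+)
  open import Data.Integer.Tactic.RingSolver using (solve)
  open import Algebra.Properties.AbelianGroup +-0-abelianGroup using (xyx⁻¹≈y)
  open import Data.List using ([]; _∷_)
  open import Data.Product using (_,_; _×_; ∃-syntax)
  open import Data.Sum using (inj₁; inj₂)
  open import Function using (_∘_)
  open import Relation.Binary.PropositionalEquality
  open import Relation.Nullary using (contradiction)

  oppositeParity-suc : ∀ n → OppositeParity (+ suc n) (+ n)
  oppositeParity-suc n with 2∣n⊎2∣1+n n
  ... | inj₁ 2∣n   = inj₂ (2∣n⇒2∤1+n 2∣n , 2∣n)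
  ... | inj₂ 2∣1+n = inj₁ (2∣1+n , λ 2∣n → 2∣n⇒2∤1+n 2∣n 2∣1+n)

  leSqrt∧sqrtLt⇒isFloorSqrt : ∀ {m} b → LeSqrt b m → SqrtLt m (b + 1ℤ) →
    ∃[ s ] b ≡ + s × IsFloorSqrt m s
  leSqrt∧sqrtLt⇒isFloorSqrt -[1+ 0 ]     _ (+<+ () , _)
  leSqrt∧sqrtLt⇒isFloorSqrt -[1+ suc _ ] _ (() , _)
  leSqrt∧sqrtLt⇒isFloorSqrt (+ 0) _ (_ , +<+ m<1) = 0 , refl , z≤n , m<1
  leSqrt∧sqrtLt⇒isFloorSqrt +[1+ s ] (inj₁ (+≤+ ())) _
  leSqrt∧sqrtLt⇒isFloorSqrt {m} +[1+ s ] (inj₂ (+≤+ [1+s]²≤m)) (_ , +<+ m<[s+2]²) =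
    suc s , refl , [1+s]²≤m , subst (λ t → m <ℕ suc t *ℕ suc t) (ℕ.+-comm s 1) m<[s+2]²

  sqrtLe∧ltSqrt⇒isFloorSqrt : ∀ {m} → NonSquare m → ∀ a → SqrtLe m a → LtSqrt (a - 1ℤ) m →
    ∃[ s ] a ≡ + suc s × IsFloorSqrt m s
  sqrtLe∧ltSqrt⇒isFloorSqrt _ -[1+ _ ] (() , _) _
  sqrtLe∧ltSqrt⇒isFloorSqrt m≢□ (+ 0) (_ , +≤+ m≤0) _ =
    contradiction (sym (ℕ.n≤0⇒n≡0 m≤0)) (m≢□ 0)
  sqrtLe∧ltSqrt⇒isFloorSqrt _ +[1+ s ] _ (inj₁ (+<+ ()))
  sqrtLe∧ltSqrt⇒isFloorSqrt {m} m≢□ +[1+ s ] (_ , +≤+ m≤[1+s]²) (inj₂ s²<m) =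
    s , refl , ℕ.<⇒≤ (drop‿+<+ (subst (_< + m) (sym (pos-* s s)) s²<m)) ,
    ℕ.≤∧≢⇒< m≤[1+s]² (m≢□ (suc s) ∘ sym)

  floorSqrt-of-floors : ∀ {m} a b k l → NonSquare m →
    IsFloorMinusSqrt a m k → IsFloorSqrtMinus m b l →
    ∃[ s ] IsFloorSqrt m s × a - k ≡ + suc s × l + b ≡ + s
  floorSqrt-of-floors a b k l m≢□ (√m≤a-k , a-k-1<√m) (l+b≤√m , √m<l+b+1)
    with s , a-k≡1+s , s-floor ← sqrtLe∧ltSqrt⇒isFloorSqrt m≢□ (a - k) √m≤a-k a-k-1<√m
       | t , l+b≡t   , t-floor ← leSqrt∧sqrtLt⇒isFloorSqrt (l + b) l+b≤√m √m<l+b+1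
    = s , s-floor , a-k≡1+s , trans l+b≡t (cong +_ (isFloorSqrt-unique t-floor s-floor))

  floor-sum : ∀ a b k l {s} → a - k ≡ + suc s → l + b ≡ + s → a - b ≡ k + l + 1ℤ
  floor-sum a b k l a-k≡1+s l+b≡s = begin
    a - b                               ≡⟨ solve (a ∷ b ∷ k ∷ l ∷ []) ⟩
    k + l + ((a - k) - (l + b))         ≡⟨ cong (λ x → k + l + (x - (l + b))) a-k≡1+[l+b] ⟩
    k + l + ((1ℤ + (l + b)) - (l + b))  ≡⟨ solve (k ∷ l ∷ b ∷ []) ⟩
    k + l + 1ℤ                          ∎
    where
    open ≡-Reasoning
    a-k≡1+[l+b] : a - k ≡ 1ℤ + (l + b)
    a-k≡1+[l+b] = trans a-k≡1+s (cong (λ x → 1ℤ + x) (sym l+b≡s))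

  [2s+1]²<4m⇒fracBelowHalf : ∀ {a k m s} → a - k ≡ + suc s → IsFloorSqrt m s →
    (2 *ℕ s +ℕ 1) *ℕ (2 *ℕ s +ℕ 1) <ℕ 4 *ℕ m → FracMinusSqrtBetween0Half a m k
  [2s+1]²<4m⇒fracBelowHalf {m = m} {s} a-k≡1+s (_ , m<[1+s]²) [2s+1]²<4m =
    subst (λ c → SqrtLt m c × LtSqrt (c + c - 1ℤ) (4 *ℕ m)) (sym a-k≡1+s)
      ((+<+ (s≤s z≤n) , +<+ m<[1+s]²) ,
       inj₂ (subst (_< + (4 *ℕ m)) (pos-* (s +ℕ suc s) (s +ℕ suc s))
         (+<+ (subst (λ t → t *ℕ t <ℕ 4 *ℕ m) 2s+1≡s+[1+s] [2s+1]²<4m))))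
    where
    2s+1≡s+[1+s] : 2 *ℕ s +ℕ 1 ≡ s +ℕ suc s
    2s+1≡s+[1+s] = ℕ-Solver.solve (s ∷ [])

  -- Stated for integer variables q and f (used at + q and + f) so that the ring solver applies.
  evenGap-floorValues : ∀ (q f : ℤ) {k l} →
    (q + + 2 * (1ℤ + f)) - k ≡ 1ℤ + (q + f) → l + q ≡ q + f → k ≡ 1ℤ + f × l ≡ f
  evenGap-floorValues q f {k} {l} r-k≡1+q+f l+q≡q+f = k≡1+f , l≡f
    where
    open ≡-Reasoning
    k≡1+f : k ≡ 1ℤ + f
    k≡1+f = begin
      k                                        ≡⟨ solve (q ∷ f ∷ k ∷ []) ⟩
      (q + + 2 * (1ℤ + f)) - ((q + + 2 * (1ℤ + f)) - k)
        ≡⟨ cong ((q + + 2 * (1ℤ + f)) -_) r-k≡1+q+f ⟩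
      (q + + 2 * (1ℤ + f)) - (1ℤ + (q + f))    ≡⟨ solve (q ∷ f ∷ []) ⟩
      1ℤ + f                                   ∎
    l≡f : l ≡ f
    l≡f = begin
      l            ≡⟨ solve (l ∷ q ∷ []) ⟩
      (l + q) - q  ≡⟨ cong (_- q) l+q≡q+f ⟩
      (q + f) - q  ≡⟨ solve (q ∷ f ∷ []) ⟩
      f            ∎

  evenGap-floors : ∀ {q r f s} k l → r ≡ q +ℕ 2 *ℕ suc f → suc f *ℕ suc f ≤ℕ q →
    IsFloorSqrt (q *ℕ r) s → + r - k ≡ + suc s → l + + q ≡ + s →
      (+ r - + q ≡ + 2 * k) × (+ r - + q ≡ + 2 * (l + 1ℤ))
      × FracMinusSqrtBetween0Half (+ r) (q *ℕ r) k × OppositeParity k l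
  evenGap-floors {q} {f = f} {s} k l refl [1+f]²≤q s-floor r-k≡1+s l+q≡s
    with refl ← isFloorSqrt-unique {s = s} {q +ℕ f} s-floor (isFloorSqrt-evenGap q f [1+f]²≤q)
    with refl , refl ← evenGap-floorValues (+ q) (+ f) {k} {l} r-k≡1+s l+q≡s
    = r-q≡2[1+f]
    , trans r-q≡2[1+f] (cong (+ 2 *_) (+-comm 1ℤ (+ f)))
    , [2s+1]²<4m⇒fracBelowHalf {+ (q +ℕ 2 *ℕ suc f)} {1ℤ + + f} r-k≡1+s s-floor
        ([2[q+f]+1]²<4q[q+2[1+f]] q f [1+f]²≤q)
    , oppositeParity-suc f
    where
    r-q≡2[1+f] : + (q +ℕ 2 *ℕ suc f) - + q ≡ + 2 * (1ℤ + + f)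
    r-q≡2[1+f] = xyx⁻¹≈y (+ q) (+ 2 * (1ℤ + + f))

open import Data.Nat using (ℕ; suc; _≤_; _∸_; _^_; _<_) renaming (_*_ to _*ℕ_)
open import Data.Nat.Properties using (<⇒≤; <⇒≢; m≤n⇒m≤1+n)
open import Data.Integer using (ℤ; +_; _+_; _-_; _*_; 1ℤ)
open import Data.Product using (_×_; _,_; proj₁)
open import Relation.Binary.PropositionalEquality using (_≡_; _≢_)

theorem3p4 : (∀ n q r → 1 ≤ n → n ≢ 4 → IsNthPrime n q → IsNthPrime (suc n) r →
    (r ∸ q) ^ 2 < 2 *ℕ q) →
    ∀ n q r → 1 ≤ n → IsNthPrime n q → IsNthPrime (suc n) r →
    ∀ k l → IsFloorMinusSqrt (+ r) (q *ℕ r) k →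
    IsFloorSqrtMinus (q *ℕ r) (+ q) l →
    ((+ r - + q) ≡ k + l + 1ℤ)
    × (2 ≤ n →
    ((+ r - + q) ≡ + 2 * k)
    × ((+ r - + q) ≡ + 2 * (l + 1ℤ))
    × FracMinusSqrtBetween0Half (+ r) (q *ℕ r) k
    × OppositeParity k l)
theorem3p4 bound n q r 1≤n pₙ pₙ₊₁ k l k-floor l-floor =
  let s , s-floor , r-k≡1+s , l+q≡s =
        floorSqrt-of-floors (+ r) (+ q) k l qr-nonSquare k-floor l-floor
  in floor-sum (+ r) (+ q) k l r-k≡1+s l+q≡s , λ 2≤n →
    let f , r≡q+2[1+f] = 2∤<2∤⇒evenGap (nthPrime-odd 2≤n pₙ)
                           (nthPrime-odd (m≤n⇒m≤1+n 2≤n) pₙ₊₁) (nthPrime-< pₙ pₙ₊₁)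
        [1+f]²<q = gap²<4q⇒halfGap²<q r≡q+2[1+f] (squareGapBound⇒gap²<4p bound 1≤n pₙ pₙ₊₁)
    in evenGap-floors k l r≡q+2[1+f] (<⇒≤ [1+f]²<q) s-floor r-k≡1+s l+q≡s
  where
  qr-nonSquare : NonSquare (q *ℕ r)
  qr-nonSquare = nonSquare-*-distinctPrimes (proj₁ pₙ) (proj₁ pₙ₊₁) (<⇒≢ (nthPrime-< pₙ pₙ₊₁))
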